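{- There exists a set of $56$ distinct lines through the origin in $\mathbb{R}^{18}$ which is equiangular with angle $1/5$; that is, there exist unit vectors $v_1,\dots,v_{56} \in \mathbb{R}^{18}$ such that $|\langle v_i, v_j\rangle| = \frac{1}{5}$ for all $1 \le i < j \le 56$.
   Context: A set of lines through the origin in $\mathbb{R}^d$ is called equiangular with angle $\alpha$ if, representing each line by a unit vector parallel to it, any two distinct lines with representatives $v, v'$ satisfy $|\langle v, v'\rangle| = \alpha$ (i.e. each pair of lines forms the angle $\arccos \alpha$). -}

module Defs where

open import Level using (Level; _⊔_) renaming (suc to lsuc)
open import Data.Nat using (ℕ; zero; suc)
open import Data.Fin using (Fin)
import Data.Fin as Fin
open import Data.Product using (Σ; ∃; _×_; _,_)
open import Relation.Nullary using (¬_)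
open import Algebra.Bundles using (CommutativeRing)
open import Relation.Binary.Structures using (IsTotalOrder)

-- The real numbers, axiomatised as a Dedekind-complete ordered field.
-- (Any two such structures are isomorphic, so quantifying over all of them
-- is the same as speaking about ℝ.)
record CompleteOrderedField (c ℓ ℓ' : Level) : Set (lsuc (c ⊔ ℓ ⊔ ℓ')) where
  field
    commRing : CommutativeRing c ℓ
  open CommutativeRing commRing public hiding (ring; zero)
  field
    _≤_          : Carrier → Carrier → Set ℓ'
    isTotalOrder : IsTotalOrder _≈_ _≤_
    0≉1          : ¬ (0# ≈ 1#)
    inverse      : ∀ x → ¬ (x ≈ 0#) → ∃ λ y → x * y ≈ 1#
    +-monoˡ-≤    : ∀ {x y} z → x ≤ y → (x + z) ≤ (y + z)
    *-nonneg     : ∀ {x y} → 0# ≤ x → 0# ≤ y → 0# ≤ (x * y)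
    sup          : (P : Carrier → Set (c ⊔ ℓ ⊔ ℓ')) →
                   ∃ P →
                   (∃ λ b → ∀ x → P x → x ≤ b) →
                   ∃ λ s → (∀ x → P x → x ≤ s) ×
                           (∀ b → (∀ x → P x → x ≤ b) → s ≤ b)

module _ {c ℓ ℓ' : Level} (R : CompleteOrderedField c ℓ ℓ') where
  open CompleteOrderedField R

  fromℕ : ℕ → Carrier
  fromℕ zero    = 0#
  fromℕ (suc n) = 1# + fromℕ n

  sumFin : ∀ d → (Fin d → Carrier) → Carrier
  sumFin zero    f = 0#
  sumFin (suc d) f = f Fin.zero + sumFin d (λ i → f (Fin.suc i))

  inner : ∀ {d} → (Fin d → Carrier) → (Fin d → Carrier) → Carrier
  inner {d} u v = sumFin d (λ i → u i * v i)

-- The vectors are v i = (a i + b i √6 w) / D for integer data a i ∈ ℤ¹⁸, b i ∈ ℤ,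
-- w = (1, 1, 2, 0, …, 0) and D = 1610281920.  Computed exactly in ℤ[√6], their
-- Gram matrix is D² on the diagonal and ±D²/5 off it, which is checked by
-- evaluation.  To transport this into an arbitrary complete ordered field, √6 is
-- obtained as the supremum of {x | x² ≤ 6}, and evaluation at it is a ring
-- homomorphism from ℤ[√6] to the field.

module Submission where

open import Defs
open import Level using (Lift; lift; lower; _⊔_)
open import Function using (_∘_)
open import Data.Nat as ℕ using (ℕ; zero; suc)
import Data.Nat.Properties as ℕ
open import Data.Integer as ℤ using (ℤ; +_; -[1+_]; sign; ∣_∣; _◃_)
import Data.Integer.Properties as ℤ
open import Data.Sign as Sign using (Sign)
open import Data.Fin as Fin using (Fin)
open import Data.Maybe using (Maybe; just; nothing)
open import Data.Product using (∃; _×_; _,_; proj₁; proj₂)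
open import Data.Sum as Sum using (_⊎_; inj₁; inj₂)
open import Data.Vec using (Vec; _∷_; []; lookup)
open import Data.Fin.Properties using (all?)
open import Relation.Nullary using (¬_; yes; no)
open import Relation.Nullary.Decidable using (map′; toWitness; ¬?; _×-dec_; _⊎-dec_; _→-dec_)
open import Relation.Binary.Definitions using (DecidableEquality)
open import Relation.Binary.PropositionalEquality as ≡ using (_≡_; _≢_)
open import Relation.Binary.Bundles using (TotalOrder)
open import Algebra.Bundles using (CommutativeRing)
open import Algebra.Solver.Ring.AlmostCommutativeRing using (_-Raw-AlmostCommutative⟶_; fromCommutativeRing)

module IntegerEmbedding {c ℓ} (CR : CommutativeRing c ℓ) where
  open CommutativeRing CR
  open import Algebra.Properties.Ring ring using (-1*x≈-x; -‿involutive; -0#≈0#)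
  open import Algebra.Properties.AbelianGroup +-abelianGroup using (⁻¹-∙-comm; xyx⁻¹≈y)
  open import Algebra.Properties.CommutativeSemigroup *-commutativeSemigroup using (interchange)
  open import Algebra.Properties.Semiring.Mult semiring as Mult using (×-homo-+; ×1-homo-*)
  open import Relation.Binary.Reasoning.Setoid setoid

  fromℤ : ℤ → Carrier
  fromℤ (+ n)    = n Mult.× 1#
  fromℤ -[1+ n ] = - (suc n Mult.× 1#)

  fromSign : Sign → Carrier
  fromSign Sign.+ = 1#
  fromSign Sign.- = - 1#

  fromSign-homo-* : ∀ s t → fromSign (s Sign.* t) ≈ fromSign s * fromSign t
  fromSign-homo-* Sign.+ t      = sym (*-identityˡ _)
  fromSign-homo-* Sign.- Sign.+ = sym (*-identityʳ _)
  fromSign-homo-* Sign.- Sign.- = sym (trans (-1*x≈-x _) (-‿involutive _))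

  fromℤ-◃ : ∀ s n → fromℤ (s ◃ n) ≈ fromSign s * (n Mult.× 1#)
  fromℤ-◃ s      zero    = sym (zeroʳ _)
  fromℤ-◃ Sign.+ (suc n) = sym (*-identityˡ _)
  fromℤ-◃ Sign.- (suc n) = sym (-1*x≈-x _)

  fromℤ-sign-abs : ∀ i → fromℤ i ≈ fromSign (sign i) * (∣ i ∣ Mult.× 1#)
  fromℤ-sign-abs i = trans (reflexive (≡.cong fromℤ (≡.sym (ℤ.◃-inverse i)))) (fromℤ-◃ (sign i) ∣ i ∣)

  fromℤ-homo-* : ∀ i j → fromℤ (i ℤ.* j) ≈ fromℤ i * fromℤ j
  fromℤ-homo-* i j = begin
    fromℤ (sign i Sign.* sign j ◃ ∣ i ∣ ℕ.* ∣ j ∣)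
      ≈⟨ fromℤ-◃ (sign i Sign.* sign j) (∣ i ∣ ℕ.* ∣ j ∣) ⟩
    fromSign (sign i Sign.* sign j) * ((∣ i ∣ ℕ.* ∣ j ∣) Mult.× 1#)
      ≈⟨ *-cong (fromSign-homo-* (sign i) (sign j)) (×1-homo-* ∣ i ∣ ∣ j ∣) ⟩
    (fromSign (sign i) * fromSign (sign j)) * (∣ i ∣ Mult.× 1# * ∣ j ∣ Mult.× 1#)
      ≈⟨ interchange _ _ _ _ ⟩
    (fromSign (sign i) * ∣ i ∣ Mult.× 1#) * (fromSign (sign j) * ∣ j ∣ Mult.× 1#)
      ≈⟨ *-cong (fromℤ-sign-abs i) (fromℤ-sign-abs j) ⟨
    fromℤ i * fromℤ j
      ∎

  fromℤ-⊖ : ∀ m n → fromℤ (m ℤ.⊖ n) ≈ m Mult.× 1# - n Mult.× 1#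
  fromℤ-⊖ zero    zero    = sym (-‿inverseʳ 0#)
  fromℤ-⊖ zero    (suc n) = sym (+-identityˡ _)
  fromℤ-⊖ (suc m) zero    = sym (trans (+-congˡ -0#≈0#) (+-identityʳ _))
  fromℤ-⊖ (suc m) (suc n) = begin
    fromℤ (suc m ℤ.⊖ suc n)                    ≡⟨ ≡.cong fromℤ (ℤ.[1+m]⊖[1+n]≡m⊖n m n) ⟩
    fromℤ (m ℤ.⊖ n)                            ≈⟨ fromℤ-⊖ m n ⟩
    m Mult.× 1# - n Mult.× 1#                  ≈⟨ +-congʳ (xyx⁻¹≈y 1# (m Mult.× 1#)) ⟨
    (1# + m Mult.× 1#) - 1# - n Mult.× 1#      ≈⟨ +-assoc _ (- 1#) _ ⟩
    (1# + m Mult.× 1#) + (- 1# - n Mult.× 1#)  ≈⟨ +-congˡ (⁻¹-∙-comm 1# (n Mult.× 1#)) ⟩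
    (1# + m Mult.× 1#) - (1# + n Mult.× 1#)    ∎

  fromℤ-homo-+ : ∀ i j → fromℤ (i ℤ.+ j) ≈ fromℤ i + fromℤ j
  fromℤ-homo-+ -[1+ m ] -[1+ n ] = begin
    - (suc (suc m ℕ.+ n) Mult.× 1#)        ≡⟨ ≡.cong (λ k → - (suc k Mult.× 1#)) (ℕ.+-suc m n) ⟨
    - ((suc m ℕ.+ suc n) Mult.× 1#)        ≈⟨ -‿cong (×-homo-+ 1# (suc m) (suc n)) ⟩
    - (suc m Mult.× 1# + suc n Mult.× 1#)  ≈⟨ ⁻¹-∙-comm _ _ ⟨
    - (suc m Mult.× 1#) - suc n Mult.× 1#  ∎
  fromℤ-homo-+ -[1+ m ] (+ n)    = trans (fromℤ-⊖ n (suc m)) (+-comm _ _)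
  fromℤ-homo-+ (+ m)    -[1+ n ] = fromℤ-⊖ m (suc n)
  fromℤ-homo-+ (+ m)    (+ n)    = ×-homo-+ 1# m n

  fromℤ-homo-neg : ∀ i → fromℤ (ℤ.- i) ≈ - fromℤ i
  fromℤ-homo-neg -[1+ n ]  = sym (-‿involutive _)
  fromℤ-homo-neg (+ zero)  = sym -0#≈0#
  fromℤ-homo-neg (+ suc n) = refl

  fromℤ-morphism : ℤ.+-*-rawRing -Raw-AlmostCommutative⟶ fromCommutativeRing CR
  fromℤ-morphism = record
    { ⟦_⟧ = fromℤ ; +-homo = fromℤ-homo-+ ; *-homo = fromℤ-homo-* ; -‿homo = fromℤ-homo-neg
    ; 0-homo = refl ; 1-homo = +-identityʳ 1# }

module CommutativeRingSolver {c ℓ} (CR : CommutativeRing c ℓ) where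
  open CommutativeRing CR using (_≈_; refl)
  open IntegerEmbedding CR using (fromℤ; fromℤ-morphism)

  private
    decideℤ : ∀ i j → Maybe (fromℤ i ≈ fromℤ j)
    decideℤ i j with i ℤ.≟ j
    ... | yes ≡.refl = just refl
    ... | no _       = nothing

  open import Algebra.Solver.Ring ℤ.+-*-rawRing (fromCommutativeRing CR) fromℤ-morphism decideℤ public

module OrderedFieldProperties {c ℓ ℓ'} (R : CompleteOrderedField c ℓ ℓ') where
  open CompleteOrderedField R hiding (_≤_)
  open IntegerEmbedding commRing using (fromℤ)
  open CommutativeRingSolver commRing using (solve; _:=_; _:+_; _:*_; _:-_; :-_)
  open import Algebra.Properties.AbelianGroup +-abelianGroup using (⁻¹-anti-homo‿-)

  totalOrder : TotalOrder c ℓ ℓ'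
  totalOrder = record { isTotalOrder = isTotalOrder }

  open TotalOrder totalOrder
    using (_≤_; total; antisym) renaming (reflexive to ≤-reflexive; trans to ≤-trans)
  open import Relation.Binary.Reasoning.PartialOrder (TotalOrder.poset totalOrder)

  +-monoʳ-≤ : ∀ z {x y} → x ≤ y → z + x ≤ z + y
  +-monoʳ-≤ z {x} {y} x≤y = begin
    z + x ≈⟨ +-comm z x ⟩
    x + z ≤⟨ +-monoˡ-≤ z x≤y ⟩
    y + z ≈⟨ +-comm y z ⟩
    z + y ∎

  +-mono-≤ : ∀ {x y u v} → x ≤ y → u ≤ v → x + u ≤ y + v
  +-mono-≤ {y = y} {u} x≤y u≤v = ≤-trans (+-monoˡ-≤ u x≤y) (+-monoʳ-≤ y u≤v)

  +-cancelˡ-≤ : ∀ z {x y} → z + x ≤ z + y → x ≤ y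
  +-cancelˡ-≤ z {x} {y} z+x≤z+y = begin
    x             ≈⟨ solve 2 (λ x z → x := :- z :+ (z :+ x)) refl x z ⟩
    - z + (z + x) ≤⟨ +-monoʳ-≤ (- z) z+x≤z+y ⟩
    - z + (z + y) ≈⟨ solve 2 (λ y z → :- z :+ (z :+ y) := y) refl y z ⟩
    y             ∎

  x≤y⇒0≤y-x : ∀ {x y} → x ≤ y → 0# ≤ y - x
  x≤y⇒0≤y-x {x} {y} x≤y = begin
    0#    ≈⟨ -‿inverseʳ x ⟨
    x - x ≤⟨ +-monoˡ-≤ (- x) x≤y ⟩
    y - x ∎

  0≤y-x⇒x≤y : ∀ {x y} → 0# ≤ y - x → x ≤ y
  0≤y-x⇒x≤y {x} {y} 0≤y-x = begin
    x           ≈⟨ +-identityˡ x ⟨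
    0# + x      ≤⟨ +-monoˡ-≤ x 0≤y-x ⟩
    (y - x) + x ≈⟨ solve 2 (λ x y → (y :- x) :+ x := y) refl x y ⟩
    y           ∎

  *-monoʳ-≤ : ∀ {z x y} → 0# ≤ z → x ≤ y → x * z ≤ y * z
  *-monoʳ-≤ {z} {x} {y} 0≤z x≤y = 0≤y-x⇒x≤y (begin
    0#            ≤⟨ *-nonneg (x≤y⇒0≤y-x x≤y) 0≤z ⟩
    (y - x) * z   ≈⟨ solve 3 (λ x y z → (y :- x) :* z := y :* z :- x :* z) refl x y z ⟩
    y * z - x * z ∎)

  *-monoˡ-≤ : ∀ {z x y} → 0# ≤ z → x ≤ y → z * x ≤ z * y
  *-monoˡ-≤ {z} {x} {y} 0≤z x≤y = begin
    z * x ≈⟨ *-comm z x ⟩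
    x * z ≤⟨ *-monoʳ-≤ 0≤z x≤y ⟩
    y * z ≈⟨ *-comm y z ⟩
    z * y ∎

  *-mono-≤ : ∀ {x y u v} → 0# ≤ x → 0# ≤ v → x ≤ y → u ≤ v → x * u ≤ y * v
  *-mono-≤ 0≤x 0≤v x≤y u≤v = ≤-trans (*-monoˡ-≤ 0≤x u≤v) (*-monoʳ-≤ 0≤v x≤y)

  x≤0⇒0≤-x : ∀ {x} → x ≤ 0# → 0# ≤ - x
  x≤0⇒0≤-x {x} x≤0 = begin
    0#     ≈⟨ -‿inverseʳ x ⟨
    x - x  ≤⟨ +-monoˡ-≤ (- x) x≤0 ⟩
    0# - x ≈⟨ +-identityˡ (- x) ⟩
    - x    ∎

  0≤x*x : ∀ x → 0# ≤ x * x
  0≤x*x x with total 0# x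
  ... | inj₁ 0≤x = *-nonneg 0≤x 0≤x
  ... | inj₂ x≤0 = begin
    0#        ≤⟨ *-nonneg (x≤0⇒0≤-x x≤0) (x≤0⇒0≤-x x≤0) ⟩
    - x * - x ≈⟨ solve 1 (λ x → :- x :* :- x := x :* x) refl x ⟩
    x * x     ∎

  0≤1 : 0# ≤ 1#
  0≤1 = ≤-trans (0≤x*x 1#) (≤-reflexive (*-identityˡ 1#))

  1≤x⇒x≉0 : ∀ {x} → 1# ≤ x → ¬ (x ≈ 0#)
  1≤x⇒x≉0 1≤x x≈0 = 0≉1 (antisym 0≤1 (≤-trans 1≤x (≤-reflexive x≈0)))

  0≤fromℤ[+n] : ∀ n → 0# ≤ fromℤ (+ n)
  0≤fromℤ[+n] zero    = ≤-reflexive refl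
  0≤fromℤ[+n] (suc n) = ≤-trans (≤-reflexive (sym (+-identityˡ 0#))) (+-mono-≤ 0≤1 (0≤fromℤ[+n] n))

  1≤fromℤ[+1+n] : ∀ n → 1# ≤ fromℤ (+ suc n)
  1≤fromℤ[+1+n] n = ≤-trans (≤-reflexive (sym (+-identityʳ 1#))) (+-monoʳ-≤ 1# (0≤fromℤ[+n] n))

  x*y≈0⇒x≈0 : ∀ {x y} → ¬ (y ≈ 0#) → x * y ≈ 0# → x ≈ 0#
  x*y≈0⇒x≈0 {x} {y} y≉0 xy≈0 with inverse y y≉0
  ... | y⁻¹ , yy⁻¹≈1 = begin-equality
    x              ≈⟨ *-identityʳ x ⟨
    x * 1#         ≈⟨ *-congˡ yy⁻¹≈1 ⟨
    x * (y * y⁻¹)  ≈⟨ *-assoc x y y⁻¹ ⟨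
    (x * y) * y⁻¹  ≈⟨ *-congʳ xy≈0 ⟩
    0# * y⁻¹       ≈⟨ zeroˡ y⁻¹ ⟩
    0#             ∎

  reciprocal : ∀ {x} → 1# ≤ x → ∃ λ y → 0# ≤ y × x * y ≈ 1#
  reciprocal {x} 1≤x with inverse x (1≤x⇒x≉0 1≤x)
  ... | y , xy≈1 = y , 0≤y , xy≈1
    where
    0≤y : 0# ≤ y
    0≤y = begin
      0#            ≤⟨ *-nonneg (≤-trans 0≤1 1≤x) (0≤x*x y) ⟩
      x * (y * y)   ≈⟨ *-assoc x y y ⟨
      (x * y) * y   ≈⟨ *-congʳ xy≈1 ⟩
      1# * y        ≈⟨ *-identityˡ y ⟩
      y             ∎

  x*x≤y*y⇒x≤y : ∀ {x y} → 0# ≤ y → ¬ (y ≈ 0#) → x * x ≤ y * y → x ≤ y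
  x*x≤y*y⇒x≤y {x} {y} 0≤y y≉0 xx≤yy with total x y
  ... | inj₁ x≤y = x≤y
  ... | inj₂ y≤x = ≤-reflexive x≈y
    where
    x+y≉0 : ¬ (x + y ≈ 0#)
    x+y≉0 x+y≈0 = y≉0 (antisym (begin
      y      ≈⟨ +-identityˡ y ⟨
      0# + y ≤⟨ +-monoˡ-≤ y (≤-trans 0≤y y≤x) ⟩
      x + y  ≈⟨ x+y≈0 ⟩
      0#     ∎) 0≤y)
    [x-y][x+y]≈0 : (x - y) * (x + y) ≈ 0#
    [x-y][x+y]≈0 = begin-equality
      (x - y) * (x + y) ≈⟨ solve 2 (λ x y → (x :- y) :* (x :+ y) := x :* x :- y :* y) refl x y ⟩
      x * x - y * y     ≈⟨ +-congʳ (antisym xx≤yy (*-mono-≤ 0≤y (≤-trans 0≤y y≤x) y≤x y≤x)) ⟩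
      y * y - y * y     ≈⟨ -‿inverseʳ (y * y) ⟩
      0#                ∎
    x≈y : x ≈ y
    x≈y = begin-equality
      x             ≈⟨ solve 2 (λ x y → x := (x :- y) :+ y) refl x y ⟩
      (x - y) + y   ≈⟨ +-congʳ (x*y≈0⇒x≈0 x+y≉0 [x-y][x+y]≈0) ⟩
      0# + y        ≈⟨ +-identityˡ y ⟩
      y             ∎

  module SquareRoot (a : Carrier) (1≤a : 1# ≤ a) where

    Below : Carrier → Set (c ⊔ ℓ ⊔ ℓ')
    Below x = Lift (c ⊔ ℓ) (x * x ≤ a)

    below⇒≤a : ∀ x → Below x → x ≤ a
    below⇒≤a x (lift xx≤a) with total x a
    ... | inj₁ x≤a = x≤a
    ... | inj₂ a≤x = begin
      x      ≈⟨ *-identityʳ x ⟨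
      x * 1# ≤⟨ *-monoˡ-≤ (≤-trans (≤-trans 0≤1 1≤a) a≤x) (≤-trans 1≤a a≤x) ⟩
      x * x  ≤⟨ xx≤a ⟩
      a      ∎

    supremum : ∃ λ s → (∀ x → Below x → x ≤ s) × (∀ b → (∀ x → Below x → x ≤ b) → s ≤ b)
    supremum = sup Below (1# , lift (≤-trans (≤-reflexive (*-identityʳ 1#)) 1≤a)) (a , below⇒≤a)

    s : Carrier
    s = proj₁ supremum

    s-upper : ∀ x → x * x ≤ a → x ≤ s
    s-upper x xx≤a = proj₁ (proj₂ supremum) x (lift xx≤a)

    s-least : ∀ b → (∀ x → x * x ≤ a → x ≤ b) → s ≤ b
    s-least b ub = proj₂ (proj₂ supremum) b (λ x → ub x ∘ lower)

    1≤s : 1# ≤ s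
    1≤s = s-upper 1# (≤-trans (≤-reflexive (*-identityʳ 1#)) 1≤a)

    0≤s : 0# ≤ s
    0≤s = ≤-trans 0≤1 1≤s

    1≤s+s : 1# ≤ s + s
    1≤s+s = ≤-trans (≤-reflexive (sym (+-identityʳ 1#))) (+-mono-≤ 1≤s 0≤s)

    -- If s² were above a, the Newton step (s² + a) / 2s would be a smaller upper bound.
    s*s≤a : s * s ≤ a
    s*s≤a with total (s * s) a | reciprocal 1≤s+s
    ... | inj₁ ss≤a | _ = ss≤a
    ... | inj₂ a≤ss | t , 0≤t , [s+s]t≈1 = +-cancelˡ-≤ (s * s) (begin
      s * s + s * s  ≈⟨ solve 1 (λ s → s :* s :+ s :* s := s :* (s :+ s)) refl s ⟩
      s * (s + s)    ≤⟨ *-monoʳ-≤ (≤-trans 0≤1 1≤s+s) s≤b ⟩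
      b * (s + s)    ≈⟨ b[s+s]≈ss+a ⟩
      s * s + a      ∎)
      where
      b : Carrier
      b = (s * s + a) * t
      b[s+s]≈ss+a : b * (s + s) ≈ s * s + a
      b[s+s]≈ss+a = begin-equality
        (s * s + a) * t * (s + s)   ≈⟨ *-assoc _ t (s + s) ⟩
        (s * s + a) * (t * (s + s)) ≈⟨ *-congˡ (trans (*-comm t (s + s)) [s+s]t≈1) ⟩
        (s * s + a) * 1#            ≈⟨ *-identityʳ _ ⟩
        s * s + a                   ∎
      1≤ss+a : 1# ≤ s * s + a
      1≤ss+a = ≤-trans (≤-reflexive (sym (+-identityˡ 1#))) (+-mono-≤ (0≤x*x s) 1≤a)
      b≉0 : ¬ (b ≈ 0#)
      b≉0 b≈0 = 1≤x⇒x≉0 1≤ss+a (trans (sym b[s+s]≈ss+a) (trans (*-congʳ b≈0) (zeroˡ _)))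
      a≤b*b : a ≤ b * b
      a≤b*b = begin
        a                                         ≈⟨ +-identityʳ a ⟨
        a + 0#                                    ≤⟨ +-monoʳ-≤ a (0≤x*x ((s * s - a) * t)) ⟩
        a + ((s * s - a) * t) * ((s * s - a) * t)
          ≈⟨ solve 3 (λ s t a → a :+ ((s :* s :- a) :* t) :* ((s :* s :- a) :* t)
                        := (s :* s :+ a) :* t :* ((s :* s :+ a) :* t) :+ (a :- a :* ((s :+ s) :* t :* ((s :+ s) :* t))))
                   refl s t a ⟩
        b * b + (a - a * ((s + s) * t * ((s + s) * t)))
          ≈⟨ +-congˡ (+-congˡ (-‿cong (*-congˡ (*-cong [s+s]t≈1 [s+s]t≈1)))) ⟩
        b * b + (a - a * (1# * 1#))               ≈⟨ +-congˡ (+-congˡ (-‿cong (trans (*-congˡ (*-identityʳ 1#)) (*-identityʳ a)))) ⟩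
        b * b + (a - a)                           ≈⟨ trans (+-congˡ (-‿inverseʳ a)) (+-identityʳ _) ⟩
        b * b                                     ∎
      s≤b : s ≤ b
      s≤b = s-least b (λ x xx≤a → x*x≤y*y⇒x≤y (*-nonneg (≤-trans 0≤1 1≤ss+a) 0≤t) b≉0 (≤-trans xx≤a a≤b*b))

    1≤s+s+a : 1# ≤ s + s + a
    1≤s+s+a = ≤-trans (≤-reflexive (sym (+-identityʳ 1#))) (+-mono-≤ 1≤s+s (≤-trans 0≤1 1≤a))

    -- If s² were below a, then s + (a - s²) / (2s + a) would still square to at most a.
    a≤s*s : a ≤ s * s
    a≤s*s with total a (s * s) | reciprocal 1≤s+s+a
    ... | inj₁ a≤ss | _ = a≤ss
    ... | inj₂ ss≤a | g , 0≤g , [s+s+a]g≈1 = 0≤y-x⇒x≤y (begin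
      0#        ≤⟨ x≤0⇒0≤-x f≤0 ⟩
      - f       ≈⟨ ⁻¹-anti-homo‿- a (s * s) ⟩
      s * s - a ∎)
      where
      f : Carrier
      f = a - s * s
      0≤f : 0# ≤ f
      0≤f = x≤y⇒0≤y-x ss≤a
      f≤a : f ≤ a
      f≤a = begin
        f           ≈⟨ +-identityʳ f ⟨
        f + 0#      ≤⟨ +-monoʳ-≤ f (0≤x*x s) ⟩
        f + s * s   ≈⟨ solve 2 (λ a s → (a :- s :* s) :+ s :* s := a) refl a s ⟩
        a           ∎
      g≤1 : g ≤ 1#
      g≤1 = begin
        g                 ≈⟨ *-identityʳ g ⟨
        g * 1#            ≤⟨ *-monoˡ-≤ 0≤g 1≤s+s+a ⟩
        g * (s + s + a)   ≈⟨ trans (*-comm g _) [s+s+a]g≈1 ⟩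
        1#                ∎
      step≤1 : (s + s) * g + f * (g * g) ≤ 1#
      step≤1 = begin
        (s + s) * g + f * (g * g) ≤⟨ +-monoʳ-≤ ((s + s) * g) (*-mono-≤ 0≤f 0≤g f≤a (≤-trans (*-monoˡ-≤ 0≤g g≤1) (≤-reflexive (*-identityʳ g)))) ⟩
        (s + s) * g + a * g       ≈⟨ distribʳ g (s + s) a ⟨
        (s + s + a) * g           ≈⟨ [s+s+a]g≈1 ⟩
        1#                        ∎
      s' : Carrier
      s' = s + f * g
      s'*s'≤a : s' * s' ≤ a
      s'*s'≤a = begin
        s' * s'                                  ≈⟨ solve 3 (λ s g a → (s :+ (a :- s :* s) :* g) :* (s :+ (a :- s :* s) :* g)
                                                       := (a :- (a :- s :* s)) :+ (a :- s :* s) :* ((s :+ s) :* g :+ (a :- s :* s) :* (g :* g)))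
                                                       refl s g a ⟩
        (a - f) + f * ((s + s) * g + f * (g * g)) ≤⟨ +-monoʳ-≤ (a - f) (*-monoˡ-≤ 0≤f step≤1) ⟩
        (a - f) + f * 1#                          ≈⟨ +-congˡ (*-identityʳ f) ⟩
        (a - f) + f                               ≈⟨ solve 2 (λ a f → (a :- f) :+ f := a) refl a f ⟩
        a                                         ∎
      fg≤0 : f * g ≤ 0#
      fg≤0 = +-cancelˡ-≤ s (begin
        s + f * g ≤⟨ s-upper s' s'*s'≤a ⟩
        s         ≈⟨ +-identityʳ s ⟨
        s + 0#    ∎)
      f≤0 : f ≤ 0#
      f≤0 = begin
        f                         ≈⟨ *-identityʳ f ⟨
        f * 1#                    ≈⟨ *-congˡ [s+s+a]g≈1 ⟨
        f * ((s + s + a) * g)     ≈⟨ solve 3 (λ f g k → f :* (k :* g) := (f :* g) :* k) refl f g (s + s + a) ⟩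
        (f * g) * (s + s + a)     ≤⟨ *-monoʳ-≤ (≤-trans 0≤1 1≤s+s+a) fg≤0 ⟩
        0# * (s + s + a)          ≈⟨ zeroˡ _ ⟩
        0#                        ∎

    s*s≈a : s * s ≈ a
    s*s≈a = antisym s*s≤a a≤s*s

  √-exists : ∀ a → 1# ≤ a → ∃ λ s → s * s ≈ a
  √-exists a 1≤a = SquareRoot.s a 1≤a , SquareRoot.s*s≈a a 1≤a

module SumProperties {c ℓ ℓ'} (R : CompleteOrderedField c ℓ ℓ') where
  open CompleteOrderedField R hiding (_≤_)
  open import Algebra.Properties.CommutativeSemigroup *-commutativeSemigroup using (interchange)
  open import Relation.Binary.Reasoning.Setoid setoid

  sumFin-cong : ∀ d {f g : Fin d → Carrier} → (∀ i → f i ≈ g i) → sumFin R d f ≈ sumFin R d g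
  sumFin-cong zero    f≈g = refl
  sumFin-cong (suc d) f≈g = +-cong (f≈g Fin.zero) (sumFin-cong d (f≈g ∘ Fin.suc))

  sumFin-*ʳ : ∀ d (f : Fin d → Carrier) x → sumFin R d (λ i → f i * x) ≈ sumFin R d f * x
  sumFin-*ʳ zero    f x = sym (zeroˡ x)
  sumFin-*ʳ (suc d) f x = begin
    f Fin.zero * x + sumFin R d (λ i → f (Fin.suc i) * x) ≈⟨ +-congˡ (sumFin-*ʳ d (f ∘ Fin.suc) x) ⟩
    f Fin.zero * x + sumFin R d (f ∘ Fin.suc) * x         ≈⟨ distribʳ x _ _ ⟨
    sumFin R (suc d) f * x                                ∎

  inner-*-scale : ∀ {d} (u v : Fin d → Carrier) x → inner R (λ i → u i * x) (λ i → v i * x) ≈ inner R u v * (x * x)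
  inner-*-scale {d} u v x = begin
    sumFin R d (λ i → (u i * x) * (v i * x)) ≈⟨ sumFin-cong d (λ i → interchange (u i) x (v i) x) ⟩
    sumFin R d (λ i → (u i * v i) * (x * x)) ≈⟨ sumFin-*ʳ d (λ i → u i * v i) (x * x) ⟩
    inner R u v * (x * x)                    ∎

record ℤ[√_] (k : ℤ) : Set where
  constructor ⟨_,_⟩
  field
    re im : ℤ

module QuadraticIntegers (k : ℤ) where

  infixl 6 _+√_
  infixl 7 _*√_

  _+√_ : ℤ[√ k ] → ℤ[√ k ] → ℤ[√ k ]
  ⟨ a , b ⟩ +√ ⟨ c , d ⟩ = ⟨ a ℤ.+ c , b ℤ.+ d ⟩

  _*√_ : ℤ[√ k ] → ℤ[√ k ] → ℤ[√ k ]
  ⟨ a , b ⟩ *√ ⟨ c , d ⟩ = ⟨ a ℤ.* c ℤ.+ k ℤ.* (b ℤ.* d) , a ℤ.* d ℤ.+ b ℤ.* c ⟩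

  sum√ : ∀ d → (Fin d → ℤ[√ k ]) → ℤ[√ k ]
  sum√ zero    f = ⟨ + 0 , + 0 ⟩
  sum√ (suc d) f = f Fin.zero +√ sum√ d (f ∘ Fin.suc)

  dot : ∀ {d} → (Fin d → ℤ[√ k ]) → (Fin d → ℤ[√ k ]) → ℤ[√ k ]
  dot {d} u v = sum√ d (λ i → u i *√ v i)

  _≟_ : DecidableEquality ℤ[√ k ]
  ⟨ a , b ⟩ ≟ ⟨ c , d ⟩ =
    map′ (λ (a≡c , b≡d) → ≡.cong₂ ⟨_,_⟩ a≡c b≡d) (λ { ≡.refl → ≡.refl , ≡.refl }) ((a ℤ.≟ c) ×-dec (b ℤ.≟ d))

module QuadraticIntegerEmbedding {c ℓ ℓ'} (R : CompleteOrderedField c ℓ ℓ') where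
  open CompleteOrderedField R hiding (_≤_)
  open IntegerEmbedding commRing using (fromℤ; fromℤ-homo-+; fromℤ-homo-*)
  open SumProperties R using (sumFin-cong)
  open CommutativeRingSolver commRing using (solve; _:=_; _:+_; _:*_)
  open import Relation.Binary.Reasoning.Setoid setoid

  module Embedding (k : ℤ) {r : Carrier} (r*r≈k : r * r ≈ fromℤ k) where
    open QuadraticIntegers k

    ⟦_⟧ : ℤ[√ k ] → Carrier
    ⟦ ⟨ a , b ⟩ ⟧ = fromℤ a + fromℤ b * r

    ⟦⟨_,0⟩⟧ : ∀ a → ⟦ ⟨ a , + 0 ⟩ ⟧ ≈ fromℤ a
    ⟦⟨ a ,0⟩⟧ = trans (+-congˡ (zeroˡ r)) (+-identityʳ (fromℤ a))

    ⟦⟧-homo-+ : ∀ x y → ⟦ x +√ y ⟧ ≈ ⟦ x ⟧ + ⟦ y ⟧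
    ⟦⟧-homo-+ ⟨ a , b ⟩ ⟨ c , d ⟩ = begin
      fromℤ (a ℤ.+ c) + fromℤ (b ℤ.+ d) * r          ≈⟨ +-cong (fromℤ-homo-+ a c) (*-congʳ (fromℤ-homo-+ b d)) ⟩
      (fromℤ a + fromℤ c) + (fromℤ b + fromℤ d) * r  ≈⟨ solve 5 (λ a b c d r → (a :+ c) :+ (b :+ d) :* r := (a :+ b :* r) :+ (c :+ d :* r))
                                                               refl (fromℤ a) (fromℤ b) (fromℤ c) (fromℤ d) r ⟩
      ⟦ ⟨ a , b ⟩ ⟧ + ⟦ ⟨ c , d ⟩ ⟧                    ∎

    ⟦⟧-homo-* : ∀ x y → ⟦ x *√ y ⟧ ≈ ⟦ x ⟧ * ⟦ y ⟧
    ⟦⟧-homo-* ⟨ a , b ⟩ ⟨ c , d ⟩ = begin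
      fromℤ (a ℤ.* c ℤ.+ k ℤ.* (b ℤ.* d)) + fromℤ (a ℤ.* d ℤ.+ b ℤ.* c) * r ≈⟨ +-cong re-part (*-congʳ im-part) ⟩
      (A * C + (r * r) * (B * D)) + (A * D + B * C) * r
        ≈⟨ solve 5 (λ A B C D r → (A :* C :+ (r :* r) :* (B :* D)) :+ (A :* D :+ B :* C) :* r := (A :+ B :* r) :* (C :+ D :* r))
                 refl A B C D r ⟩
      ⟦ ⟨ a , b ⟩ ⟧ * ⟦ ⟨ c , d ⟩ ⟧                                           ∎
      where
      A B C D : Carrier
      A = fromℤ a
      B = fromℤ b
      C = fromℤ c
      D = fromℤ d
      re-part : fromℤ (a ℤ.* c ℤ.+ k ℤ.* (b ℤ.* d)) ≈ A * C + (r * r) * (B * D)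
      re-part = begin
        fromℤ (a ℤ.* c ℤ.+ k ℤ.* (b ℤ.* d))      ≈⟨ fromℤ-homo-+ (a ℤ.* c) (k ℤ.* (b ℤ.* d)) ⟩
        fromℤ (a ℤ.* c) + fromℤ (k ℤ.* (b ℤ.* d)) ≈⟨ +-cong (fromℤ-homo-* a c) (fromℤ-homo-* k (b ℤ.* d)) ⟩
        A * C + fromℤ k * fromℤ (b ℤ.* d)          ≈⟨ +-congˡ (*-cong (sym r*r≈k) (fromℤ-homo-* b d)) ⟩
        A * C + (r * r) * (B * D)                  ∎
      im-part : fromℤ (a ℤ.* d ℤ.+ b ℤ.* c) ≈ A * D + B * C
      im-part = trans (fromℤ-homo-+ (a ℤ.* d) (b ℤ.* c)) (+-cong (fromℤ-homo-* a d) (fromℤ-homo-* b c))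

    ⟦⟧-homo-sum : ∀ d (f : Fin d → ℤ[√ k ]) → ⟦ sum√ d f ⟧ ≈ sumFin R d (⟦_⟧ ∘ f)
    ⟦⟧-homo-sum zero    f = trans (+-identityˡ (0# * r)) (zeroˡ r)
    ⟦⟧-homo-sum (suc d) f = trans (⟦⟧-homo-+ (f Fin.zero) _) (+-congˡ (⟦⟧-homo-sum d (f ∘ Fin.suc)))

    ⟦⟧-homo-dot : ∀ {d} (u v : Fin d → ℤ[√ k ]) → ⟦ dot u v ⟧ ≈ inner R (⟦_⟧ ∘ u) (⟦_⟧ ∘ v)
    ⟦⟧-homo-dot {d} u v = trans (⟦⟧-homo-sum d _) (sumFin-cong d (λ i → ⟦⟧-homo-* (u i) (v i)))

D : ℕ
D = 1610281920

-- M = D² / 5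
M : ℕ
M = 518601572375777280

module Tables where
  open import Agda.Builtin.FromNat using (Number; fromNat)
  open import Agda.Builtin.FromNeg using (Negative; fromNeg)
  open import Data.Unit using (tt)
  import Data.Nat.Literals
  import Data.Integer.Literals

  instance
    ℕ-number : Number ℕ
    ℕ-number = Data.Nat.Literals.number
    ℤ-number : Number ℤ
    ℤ-number = Data.Integer.Literals.number
    ℤ-negative : Negative ℤ
    ℤ-negative = Data.Integer.Literals.negative

  rationalParts : Vec (Vec ℤ 18) 56
  rationalParts =
      (229098432 ∷ 184166784 ∷ -206632608 ∷ 205774080 ∷ -27008496 ∷ 9002832 ∷ 154567680 ∷ 463703040 ∷ -206657376 ∷ 705829392 ∷ -616150704 ∷ 395472528 ∷ -235370688 ∷ 833405616 ∷ 186464976 ∷ 26714208 ∷ -143956320 ∷ -236725440 ∷ [])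
    ∷ (-312277824 ∷ 503524152 ∷ -95623164 ∷ -6755760 ∷ -15003558 ∷ 5001186 ∷ -729945624 ∷ -579554952 ∷ -172932756 ∷ 367454202 ∷ -309655086 ∷ -518978238 ∷ 66805848 ∷ -406381626 ∷ -257710062 ∷ -640185036 ∷ -343373436 ∷ 258936552 ∷ [])
    ∷ (-281518464 ∷ 57056928 ∷ 112230768 ∷ 334480704 ∷ 11670840 ∷ -3890280 ∷ 634793376 ∷ 294098208 ∷ -130820016 ∷ 583383672 ∷ 6149208 ∷ -643260456 ∷ 227804256 ∷ 566956488 ∷ -321476136 ∷ 348478512 ∷ 650923632 ∷ 17968416 ∷ [])
    ∷ (-121717632 ∷ 38882256 ∷ 41417688 ∷ 817761120 ∷ 551405628 ∷ -183801876 ∷ -592997520 ∷ -168710640 ∷ 112822152 ∷ 62490876 ∷ -724026420 ∷ 533959020 ∷ -260983920 ∷ -206730300 ∷ -174856308 ∷ 300127416 ∷ -26993256 ∷ 308020272 ∷ [])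
    ∷ (-4462656 ∷ 61108752 ∷ -28323048 ∷ -16480224 ∷ -610392036 ∷ -333296628 ∷ -502872528 ∷ 101664336 ∷ 284176008 ∷ -158385636 ∷ 12180012 ∷ -544594164 ∷ -236964336 ∷ 699718692 ∷ 565323372 ∷ -360110664 ∷ -639640296 ∷ 7964592 ∷ [])
    ∷ (-273624192 ∷ -126211296 ∷ 199917744 ∷ 407280192 ∷ 129214872 ∷ -43071624 ∷ 485137824 ∷ -154868448 ∷ 26966928 ∷ -383951016 ∷ 88263864 ∷ 368342712 ∷ 650906592 ∷ -509427864 ∷ 516650040 ∷ 338596080 ∷ -299719632 ∷ 530534304 ∷ [])
    ∷ (85024320 ∷ 368829912 ∷ -226927116 ∷ 343220688 ∷ -493072302 ∷ -372403206 ∷ 420645960 ∷ -348344040 ∷ -210418692 ∷ 748364274 ∷ -384044310 ∷ 199138650 ∷ -580172808 ∷ -400514994 ∷ -220514454 ∷ 141850788 ∷ 29096820 ∷ 25084680 ∷ [])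
    ∷ (-472624704 ∷ -175662624 ∷ 324143664 ∷ 26292096 ∷ 59747544 ∷ -19915848 ∷ 135528480 ∷ 406585440 ∷ 356509008 ∷ -252715176 ∷ 787553208 ∷ -349375176 ∷ -881760096 ∷ 320367912 ∷ -238477896 ∷ -203836368 ∷ 206108976 ∷ 296863968 ∷ [])
    ∷ (-700847424 ∷ 102615816 ∷ 299115804 ∷ -72531984 ∷ 542187030 ∷ 356031630 ∷ -344713896 ∷ 576140232 ∷ 452933172 ∷ 377080566 ∷ -425598498 ∷ -348591954 ∷ -88214808 ∷ 335475786 ∷ -31881378 ∷ 91457196 ∷ -513950436 ∷ -27631848 ∷ [])
    ∷ (10795392 ∷ 296252856 ∷ -153524124 ∷ -243957552 ∷ 270441450 ∷ -90147150 ∷ 753060072 ∷ 648898296 ∷ 31824012 ∷ 504418506 ∷ -79561950 ∷ 348435090 ∷ 409961112 ∷ -138414474 ∷ 489698082 ∷ -115355244 ∷ -236585436 ∷ 311548392 ∷ [])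
    ∷ (193506816 ∷ 49509360 ∷ -121508088 ∷ 404346912 ∷ 288173556 ∷ -96057852 ∷ -20438256 ∷ -61314768 ∷ 36660120 ∷ -285501900 ∷ -258578268 ∷ -548574204 ∷ 278706864 ∷ 515032332 ∷ 68660388 ∷ 1062499944 ∷ -476885304 ∷ -196039152 ∷ [])
    ∷ (-448619904 ∷ 758370072 ∷ -154875084 ∷ -41678640 ∷ -94840398 ∷ 31613466 ∷ 23228232 ∷ 69684696 ∷ -882471492 ∷ 15428754 ∷ -153145590 ∷ -323840070 ∷ -40937352 ∷ 283051374 ∷ 453303882 ∷ 149589156 ∷ -286370892 ∷ -501079416 ∷ [])
    ∷ (32791680 ∷ -281447880 ∷ 124328100 ∷ 309487440 ∷ 739987146 ∷ -246662382 ∷ -490866264 ∷ 137683128 ∷ 539683980 ∷ 152858730 ∷ 418313922 ∷ -244904334 ∷ -38982120 ∷ -121264170 ∷ -11513982 ∷ 434736084 ∷ 576176676 ∷ -633493272 ∷ [])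
    ∷ (-4462656 ∷ 61108752 ∷ -28323048 ∷ -16480224 ∷ 33720732 ∷ -11240244 ∷ -180816144 ∷ 1067833488 ∷ -681993144 ∷ 163670748 ∷ 12180012 ∷ -544594164 ∷ 85092048 ∷ 55605924 ∷ -78789396 ∷ -682167048 ∷ 4472472 ∷ 330020976 ∷ [])
    ∷ (-96757824 ∷ 332499408 ∷ -117870792 ∷ -300508896 ∷ -123267156 ∷ 577849692 ∷ 115306416 ∷ 345919248 ∷ -30925464 ∷ -8427732 ∷ -486648708 ∷ 384586716 ∷ -434744496 ∷ -475031148 ∷ 293890812 ∷ 942876696 ∷ -304487880 ∷ 55588080 ∷ [])
    ∷ (-83993280 ∷ -307779192 ∷ 195886236 ∷ -383059728 ∷ 308086806 ∷ 434065038 ∷ -553470888 ∷ -50130744 ∷ -515720268 ∷ 535741686 ∷ 277569630 ∷ -121553490 ∷ 630999144 ∷ 77461962 ∷ 184079838 ∷ -55859796 ∷ 268488732 ∷ 90533016 ∷ [])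
    ∷ (66882240 ∷ -203736360 ∷ 68427060 ∷ 67260240 ∷ 915263058 ∷ 231672954 ∷ 433557000 ∷ -309610920 ∷ 296273916 ∷ -301922382 ∷ -428245974 ∷ -33522342 ∷ -331717704 ∷ 703212558 ∷ -470991894 ∷ -180319452 ∷ 243629556 ∷ -247598712 ∷ [])
    ∷ (-210173568 ∷ -207788184 ∷ 208980876 ∷ 418221168 ∷ 249100398 ∷ -83033466 ∷ 282997368 ∷ -761289816 ∷ -118722108 ∷ 439846926 ∷ -434276778 ∷ -132188634 ∷ 133050888 ∷ 570450354 ∷ 574546902 ∷ -115843044 ∷ -398144820 ∷ 406517880 ∷ [])
    ∷ (82140288 ∷ 31407744 ∷ -56774016 ∷ -160217088 ∷ 507871008 ∷ -169290336 ∷ 401264064 ∷ -406489728 ∷ 43921920 ∷ 360881760 ∷ 124124832 ∷ -428718624 ∷ 315207744 ∷ -134920608 ∷ -546617184 ∷ 64435968 ∷ -641541120 ∷ -588127680 ∷ [])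
    ∷ (-582515904 ∷ 220523208 ∷ 180996348 ∷ 560256624 ∷ 52496358 ∷ -554259426 ∷ 162766104 ∷ 488298312 ∷ 419128980 ∷ 310074630 ∷ 199546542 ∷ -33508674 ∷ 284212584 ∷ -669886278 ∷ -604183506 ∷ -255129588 ∷ -81940548 ∷ 65881176 ∷ [])
    ∷ (-309847488 ∷ 277396056 ∷ 16225716 ∷ 41473488 ∷ -762037038 ∷ 254012346 ∷ -625862520 ∷ -267305640 ∷ 11489148 ∷ 266854194 ∷ -424344726 ∷ 146238042 ∷ 181694328 ∷ 632614734 ∷ -231172758 ∷ 595909476 ∷ 70274484 ∷ 321440712 ∷ [])
    ∷ (-193062528 ∷ 303727368 ∷ -55332420 ∷ 734020656 ∷ -8080314 ∷ 539454078 ∷ 402911256 ∷ -401548152 ∷ -543388524 ∷ -116028762 ∷ 360512334 ∷ 344943582 ∷ -488286936 ∷ 433888602 ∷ -104710194 ∷ 442392588 ∷ 55906044 ∷ 241527192 ∷ [])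
    ∷ (202294272 ∷ -241149504 ∷ 19427616 ∷ -98024832 ∷ -275784336 ∷ 91928112 ∷ -11891136 ∷ -35673408 ∷ -74238624 ∷ -779700432 ∷ -304798416 ∷ 534026352 ∷ -704343552 ∷ -3062256 ∷ -608747280 ∷ 140266080 ∷ 183879456 ∷ 388768128 ∷ [])
    ∷ (-361626432 ∷ 190668528 ∷ 85478952 ∷ 462948768 ∷ 217112580 ∷ -72370860 ∷ 310262352 ∷ -679494864 ∷ 322829304 ∷ 159431172 ∷ -15465996 ∷ -335163948 ∷ -287384016 ∷ -392725188 ∷ 277393140 ∷ -269884920 ∷ 874344360 ∷ 213570960 ∷ [])
    ∷ (45916992 ∷ 435015096 ∷ -240466044 ∷ -526023792 ∷ -61324518 ∷ -516319134 ∷ -387679896 ∷ 447242232 ∷ 350500524 ∷ 367574202 ∷ -66427374 ∷ 315345858 ∷ -476060904 ∷ 40952838 ∷ -328270830 ∷ -307020 ∷ -271547004 ∷ 813060648 ∷ [])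
    ∷ (-75277056 ∷ -275726688 ∷ 175501872 ∷ 272855616 ∷ -205341480 ∷ 68447160 ∷ -418094688 ∷ 355997856 ∷ -448221552 ∷ -35871336 ∷ -579648264 ∷ -569601672 ∷ 57068256 ∷ -618410712 ∷ -511160328 ∷ 483803376 ∷ 37425072 ∷ -303149664 ∷ [])
    ∷ (479988480 ∷ 594074952 ∷ -537031716 ∷ -326568912 ∷ 59429142 ∷ -19809714 ∷ -18165864 ∷ -54497592 ∷ -122535180 ∷ 594628470 ∷ 648872094 ∷ 230801262 ∷ 139414056 ∷ 239939658 ∷ -31160802 ∷ 780530604 ∷ 181419996 ∷ -183789672 ∷ [])
    ∷ (-698785344 ∷ 224717256 ∷ 237034044 ∷ -152210064 ∷ 172216038 ∷ 479355294 ∷ -610363752 ∷ -220809336 ∷ 288880788 ∷ 368841414 ∷ 649677678 ∷ 450691134 ∷ 13437864 ∷ -310630278 ∷ -104750610 ∷ 263439180 ∷ 81220668 ∷ 203603544 ∷ [])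
    ∷ (-149052288 ∷ 215246520 ∷ -33097116 ∷ 140885904 ∷ 626318826 ∷ 864748338 ∷ -492438168 ∷ 132967416 ∷ -322684980 ∷ -435847350 ∷ -24532638 ∷ -135607854 ∷ -607179624 ∷ -372675402 ∷ 176561250 ∷ -287969580 ∷ 350789220 ∷ -110090520 ∷ [])
    ∷ (113868864 ∷ 179016144 ∷ -146442504 ∷ 616308384 ∷ -455969940 ∷ 688750620 ∷ 4607472 ∷ 13822416 ∷ 250371816 ∷ -225391572 ∷ 637325052 ∷ -229510884 ∷ 135463056 ∷ -305643372 ∷ -6978756 ∷ -706697448 ∷ -207630408 ∷ 101477616 ∷ [])
    ∷ (-267353280 ∷ 764175216 ∷ -248410968 ∷ 621970464 ∷ -50096412 ∷ 16698804 ∷ 72923856 ∷ 218771568 ∷ 267273912 ∷ -191888604 ∷ -319360236 ∷ 96032052 ∷ -211778832 ∷ 519094044 ∷ -42884076 ∷ -694432248 ∷ 220477416 ∷ 376777488 ∷ [])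
    ∷ (-48871680 ∷ -169016952 ∷ 108944316 ∷ -665125968 ∷ -23679162 ∷ 7893054 ∷ 238127448 ∷ -895899576 ∷ -197043756 ∷ 398897382 ∷ 290704206 ∷ -154642722 ∷ -255022872 ∷ 256829274 ∷ -633889074 ∷ 59188428 ∷ 233527164 ∷ 592045272 ∷ [])
    ∷ (536075328 ∷ 94085736 ∷ -315080532 ∷ -15351120 ∷ 382194366 ∷ -664158762 ∷ -15612552 ∷ -46837656 ∷ -180141660 ∷ 432400350 ∷ -343924698 ∷ -473212554 ∷ 41848008 ∷ -206658846 ∷ -669794394 ∷ 71453628 ∷ 339578604 ∷ -98824008 ∷ [])
    ∷ (-186613056 ∷ 373007784 ∷ -93197364 ∷ -788117136 ∷ 458531982 ∷ -152843994 ∷ -211775880 ∷ -635327640 ∷ -206861436 ∷ -178704018 ∷ 133372278 ∷ 96977094 ∷ 217284552 ∷ -93730734 ∷ 14152950 ∷ -301140900 ∷ 496523724 ∷ -758969928 ∷ [])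
    ∷ (699816384 ∷ -163666536 ∷ -268074924 ∷ 112371024 ∷ -35145150 ∷ 548475690 ∷ 477538824 ∷ -177665448 ∷ 273205788 ∷ -50904606 ∷ 210016794 ∷ -695162358 ∷ -606724296 ∷ -334479138 ∷ -253740390 ∷ 466664580 ∷ 216364884 ∷ -87985848 ∷ [])
    ∷ (3431616 ∷ -122159472 ∷ 59363928 ∷ 56319264 ∷ 151264764 ∷ -50421588 ∷ -652528080 ∷ -347302320 ∷ -202149816 ∷ 162505212 ∷ 416351052 ∷ -177103764 ∷ -780031152 ∷ -54609276 ∷ 115224012 ∷ 596176056 ∷ -624114408 ∷ 198474096 ∷ [])
    ∷ (-149052288 ∷ 215246520 ∷ -33097116 ∷ 140885904 ∷ -17793942 ∷ -1067589966 ∷ -492438168 ∷ 132967416 ∷ -322684980 ∷ -435847350 ∷ -24532638 ∷ -135607854 ∷ -607179624 ∷ -372675402 ∷ 176561250 ∷ -287969580 ∷ 350789220 ∷ -110090520 ∷ [])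
    ∷ (-74731008 ∷ 421634760 ∷ -173451876 ∷ -243472656 ∷ -175714602 ∷ 595332174 ∷ -55777896 ∷ -167333688 ∷ -577192716 ∷ -183034698 ∷ 19488222 ∷ -628198674 ∷ 528253224 ∷ -249417078 ∷ -32899554 ∷ 417862188 ∷ 487915932 ∷ 335040216 ∷ [])
    ∷ (265837248 ∷ -188915208 ∷ -38461020 ∷ 551661264 ∷ 127637898 ∷ -579306606 ∷ -411126360 ∷ 376902840 ∷ -232192692 ∷ 52964394 ∷ 809389698 ∷ 334313394 ∷ -62801640 ∷ 173949270 ∷ -50098686 ∷ 134452692 ∷ -365157660 ∷ 30177000 ∷ [])
    ∷ (-114353856 ∷ 457294584 ∷ -171470364 ∷ 517484304 ∷ 348525930 ∷ 420585330 ∷ -475634904 ∷ 183377208 ∷ -297316788 ∷ 82347786 ∷ 68286114 ∷ 93328722 ∷ 606951960 ∷ 353577270 ∷ -766551390 ∷ -89347500 ∷ 38479332 ∷ -545074584 ∷ [])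
    ∷ (49387200 ∷ 199542312 ∷ -124464756 ∷ 645206448 ∷ -712926354 ∷ -299118522 ∷ 17516472 ∷ 52549416 ∷ 156030660 ∷ -400957170 ∷ 622227606 ∷ -128621082 ∷ -41620344 ∷ 225756978 ∷ -350497386 ∷ 305863452 ∷ -84734388 ∷ -534236424 ∷ [])
    ∷ (195431040 ∷ 3169440 ∷ -99300240 ∷ -210663360 ∷ -578313864 ∷ 192771288 ∷ 4939488 ∷ 14818464 ∷ -314051760 ∷ 183514680 ∷ -493387752 ∷ -399991656 ∷ -432506784 ∷ -537956472 ∷ 449030232 ∷ -407973264 ∷ 143882736 ∷ -652292832 ∷ [])
    ∷ (-486211200 ∷ 249295248 ∷ 118457976 ∷ -474272928 ∷ -62690484 ∷ -515863812 ∷ 519274032 ∷ -52459824 ∷ -356633496 ∷ -226437108 ∷ 640611036 ∷ 650247228 ∷ -306357744 ∷ -290580492 ∷ -205582500 ∷ 245354520 ∷ -442334472 ∷ -120057936 ∷ [])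
    ∷ (-779040576 ∷ -20426040 ∷ 399733308 ∷ 124084848 ∷ 415144422 ∷ -138381474 ∷ 145363416 ∷ 436090248 ∷ -478264428 ∷ -145412154 ∷ -186609618 ∷ -58184514 ∷ -191871384 ∷ -67795782 ∷ -32370258 ∷ 344136396 ∷ 296381820 ∷ -471446760 ∷ [])
    ∷ (376289472 ∷ -519945504 ∷ 71828016 ∷ -105635712 ∷ -66680328 ∷ -514533864 ∷ -598709280 ∷ -185845920 ∷ -458957616 ∷ -353895048 ∷ -270709608 ∷ -236991144 ∷ 382445856 ∷ 58031688 ∷ -12488424 ∷ 134345328 ∷ -147413136 ∷ 918976032 ∷ [])
    ∷ (-45401472 ∷ -404489736 ∷ 224945604 ∷ 506104272 ∷ -353224614 ∷ -419019102 ∷ -788952 ∷ -2366856 ∷ 252599148 ∷ -47577606 ∷ -308866350 ∷ 367559490 ∷ 501474072 ∷ -202479354 ∷ 310053522 ∷ 43302516 ∷ 742396164 ∷ 210917352 ∷ [])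
    ∷ (-166687680 ∷ -256398984 ∷ 211543332 ∷ 292447824 ∷ 51462378 ∷ -17154126 ∷ 308347752 ∷ -685238664 ∷ -204252660 ∷ 463843530 ∷ -65621790 ∷ 535235730 ∷ 42075672 ∷ -187560714 ∷ -401860638 ∷ -517398444 ∷ -371746332 ∷ -409828056 ∷ [])
    ∷ (114384384 ∷ 209541504 ∷ -161962944 ∷ 596388864 ∷ -226406304 ∷ 75468768 ∷ -705917760 ∷ -507471360 ∷ -112697664 ∷ 416661408 ∷ 262031328 ∷ 453394464 ∷ -161180160 ∷ 176942880 ∷ 618916704 ∷ -341645568 ∷ 263218752 ∷ -484826304 ∷ [])
    ∷ (333852288 ∷ 656636640 ∷ -495244464 ∷ -109444224 ∷ 285392712 ∷ 441629736 ∷ 513562272 ∷ -69595104 ∷ 37755888 ∷ -964879416 ∷ 127758696 ∷ 201353448 ∷ 337072032 ∷ -25818504 ∷ -43214616 ∷ 79572432 ∷ -240697968 ∷ -153214944 ∷ [])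
    ∷ (422245056 ∷ -198243720 ∷ -112000668 ∷ 483251472 ∷ 357354090 ∷ -119118030 ∷ 71335272 ∷ 214005816 ∷ -744889908 ∷ 370868106 ∷ -64833054 ∷ -188508462 ∷ -167368872 ∷ -305714826 ∷ 810015714 ∷ 488145492 ∷ 391966884 ∷ 186265512 ∷ [])
    ∷ (-120247104 ∷ -571007928 ∷ 345627516 ∷ -252457680 ∷ -61171962 ∷ 557151294 ∷ -482918568 ∷ 161526216 ∷ 200872788 ∷ 43424934 ∷ -565356402 ∷ 719900574 ∷ 38071464 ∷ 44871642 ∷ -94051890 ∷ -11666100 ∷ 336784764 ∷ -698941608 ∷ [])
    ∷ (-121278144 ∷ -632058648 ∷ 376668396 ∷ -212618640 ∷ 123813534 ∷ 495489462 ∷ 616075512 ∷ 237944616 ∷ -683270172 ∷ 369600894 ∷ -136825338 ∷ -1797354 ∷ -656867640 ∷ 45868290 ∷ -57617274 ∷ -97657092 ∷ -282857172 ∷ -170446536 ∷ [])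
    ∷ (778525056 ∷ -10099320 ∷ -384212868 ∷ -104165328 ∷ 643517478 ∷ -214505826 ∷ -401007336 ∷ 407259912 ∷ -124835244 ∷ -174584442 ∷ -82209426 ∷ 663504702 ∷ 166458216 ∷ 229322298 ∷ 50587566 ∷ -387131892 ∷ 520994556 ∷ 91581528 ∷ [])
    ∷ (-120732096 ∷ 65302800 ∷ 27714648 ∷ -728946912 ∷ -168615972 ∷ 56205324 ∷ 12223152 ∷ 36669456 ∷ 798040584 ∷ 222437532 ∷ -181801620 ∷ -382450740 ∷ -185682672 ∷ 414861924 ∷ 98587116 ∷ 480514488 ∷ 489690072 ∷ -176369424 ∷ [])
    ∷ (543924096 ∷ -123812664 ∷ -210055716 ∷ 160861296 ∷ 286758678 ∷ 441174414 ∷ -393391656 ∷ 430106952 ∷ 100777140 ∷ 917357430 ∷ 64833054 ∷ 188508462 ∷ -154687512 ∷ -660454326 ∷ -165902946 ∷ -166089108 ∷ -391966884 ∷ -186265512 ∷ [])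
    ∷ (-397818432 ∷ -605585112 ∷ 501701772 ∷ 118422768 ∷ -634841874 ∷ 211613958 ∷ 77047032 ∷ 231141096 ∷ -495166524 ∷ -178915122 ∷ 448019286 ∷ 260385318 ∷ 477426888 ∷ 73635954 ∷ -640577706 ∷ 9814812 ∷ 190330380 ∷ 219422520 ∷ [])
    ∷ []

  sqrt6Coefficients : Vec ℤ 56
  sqrt6Coefficients =
      -82105976 ∷ 8886437 ∷ 53490300 ∷ -31280434 ∷ -30954050 ∷ -89874580 ∷ 81929441 ∷ -9031796
    ∷ 47277299 ∷ 102204365 ∷ -48689494 ∷ 79135217 ∷ 35321885 ∷ -30954050 ∷ -20561690 ∷ 123343539
    ∷ -23335295 ∷ 61109055 ∷ 109823120 ∷ -1215205 ∷ 49122465 ∷ -38899189 ∷ 96491800 ∷ -65614798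
    ∷ -19560155 ∷ 78299660 ∷ 17174771 ∷ -78937381 ∷ 30444877 ∷ -79446554 ∷ 78989858 ∷ 1579019
    ∷ -108364889 ∷ -31515569 ∷ 15830041 ∷ 94061390 ∷ 30444877 ∷ -87391693 ∷ -118466531 ∷ -23137459
    ∷ 101057471 ∷ -91630980 ∷ 17122294 ∷ -134228261 ∷ -9358180 ∷ 122196645 ∷ -115672307 ∷ 23189936
    ∷ 39044548 ∷ -2362099 ∷ -6092213 ∷ 57015127 ∷ 31591771 ∷ -108676226 ∷ 2362099 ∷ -24284353
    ∷ []

  sqrt6Direction : Vec ℤ 18
  sqrt6Direction = 1 ∷ 1 ∷ 2 ∷ 0 ∷ 0 ∷ 0 ∷ 0 ∷ 0 ∷ 0 ∷ 0 ∷ 0 ∷ 0 ∷ 0 ∷ 0 ∷ 0 ∷ 0 ∷ 0 ∷ 0 ∷ []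

open Tables using (rationalParts; sqrt6Coefficients; sqrt6Direction)
open QuadraticIntegers (+ 6)

scaledVectors : Fin 56 → Fin 18 → ℤ[√ + 6 ]
scaledVectors i j = ⟨ lookup (lookup rationalParts i) j , lookup sqrt6Coefficients i ℤ.* lookup sqrt6Direction j ⟩

gram : Fin 56 → Fin 56 → ℤ[√ + 6 ]
gram i j = dot (scaledVectors i) (scaledVectors j)

-- Both facts are decided by evaluation; opaque keeps the proofs from being unfolded later.
opaque
  gram-diagonal : ∀ i → gram i i ≡ ⟨ + (D ℕ.* D) , + 0 ⟩
  gram-diagonal = toWitness {a? = all? (λ i → gram i i ≟ ⟨ + (D ℕ.* D) , + 0 ⟩)} _

  gram-off-diagonal : ∀ i j → i ≢ j → gram i j ≡ ⟨ + M , + 0 ⟩ ⊎ gram i j ≡ ⟨ ℤ.- + M , + 0 ⟩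
  gram-off-diagonal = toWitness
    {a? = all? λ i → all? λ j → ¬? (i Fin.≟ j) →-dec (gram i j ≟ ⟨ + M , + 0 ⟩ ⊎-dec gram i j ≟ ⟨ ℤ.- + M , + 0 ⟩)} _

module Construction {c ℓ ℓ'} (R : CompleteOrderedField c ℓ ℓ') where
  open CompleteOrderedField R hiding (_≤_)
  open IntegerEmbedding commRing using (fromℤ; fromℤ-homo-*; fromℤ-homo-neg)
  open OrderedFieldProperties R using (√-exists; reciprocal; 1≤fromℤ[+1+n])
  open SumProperties R using (inner-*-scale)
  open import Algebra.Properties.Ring (CommutativeRing.ring commRing) using (-‿distribˡ-*; -‿distribʳ-*)
  open import Algebra.Properties.CommutativeSemigroup *-commutativeSemigroup using (interchange)
  open import Relation.Binary.Reasoning.Setoid setoid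

  √6 : Carrier
  √6 = proj₁ (√-exists (fromℤ (+ 6)) (1≤fromℤ[+1+n] 5))

  √6*√6≈6 : √6 * √6 ≈ fromℤ (+ 6)
  √6*√6≈6 = proj₂ (√-exists (fromℤ (+ 6)) (1≤fromℤ[+1+n] 5))

  open QuadraticIntegerEmbedding.Embedding R (+ 6) √6*√6≈6 using (⟦_⟧; ⟦⟨_,0⟩⟧; ⟦⟧-homo-dot)

  D⁻¹ : Carrier
  D⁻¹ = proj₁ (reciprocal (1≤fromℤ[+1+n] (D ℕ.∸ 1)))

  DD⁻¹≈1 : fromℤ (+ D) * D⁻¹ ≈ 1#
  DD⁻¹≈1 = proj₂ (proj₂ (reciprocal (1≤fromℤ[+1+n] (D ℕ.∸ 1))))

  vectors : Fin 56 → Fin 18 → Carrier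
  vectors i j = ⟦ scaledVectors i j ⟧ * D⁻¹

  inner-vectors : ∀ i j → inner R (vectors i) (vectors j) ≈ ⟦ gram i j ⟧ * (D⁻¹ * D⁻¹)
  inner-vectors i j = begin
    inner R (vectors i) (vectors j)                       ≈⟨ inner-*-scale (⟦_⟧ ∘ scaledVectors i) (⟦_⟧ ∘ scaledVectors j) D⁻¹ ⟩
    inner R (⟦_⟧ ∘ scaledVectors i) (⟦_⟧ ∘ scaledVectors j) * (D⁻¹ * D⁻¹) ≈⟨ *-congʳ (⟦⟧-homo-dot (scaledVectors i) (scaledVectors j)) ⟨
    ⟦ gram i j ⟧ * (D⁻¹ * D⁻¹)                             ∎

  D²D⁻²≈1 : fromℤ (+ (D ℕ.* D)) * (D⁻¹ * D⁻¹) ≈ 1#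
  D²D⁻²≈1 = begin
    fromℤ (+ (D ℕ.* D)) * (D⁻¹ * D⁻¹)                 ≈⟨ *-congʳ (fromℤ-homo-* (+ D) (+ D)) ⟩
    (fromℤ (+ D) * fromℤ (+ D)) * (D⁻¹ * D⁻¹)        ≈⟨ interchange _ _ _ _ ⟩
    (fromℤ (+ D) * D⁻¹) * (fromℤ (+ D) * D⁻¹)        ≈⟨ *-cong DD⁻¹≈1 DD⁻¹≈1 ⟩
    1# * 1#                                           ≈⟨ *-identityʳ 1# ⟩
    1#                                                ∎

  -- fromℕ R 5 and fromℤ (+ 5) are definitionally equal.
  5MD⁻²≈1 : fromℕ R 5 * (fromℤ (+ M) * (D⁻¹ * D⁻¹)) ≈ 1#
  5MD⁻²≈1 = begin
    fromℤ (+ 5) * (fromℤ (+ M) * (D⁻¹ * D⁻¹))  ≈⟨ *-assoc _ _ _ ⟨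
    (fromℤ (+ 5) * fromℤ (+ M)) * (D⁻¹ * D⁻¹)  ≈⟨ *-congʳ (fromℤ-homo-* (+ 5) (+ M)) ⟨
    fromℤ (+ (5 ℕ.* M)) * (D⁻¹ * D⁻¹)          ≡⟨ ≡.cong (λ n → fromℤ (+ n) * (D⁻¹ * D⁻¹)) 5M≡D² ⟩
    fromℤ (+ (D ℕ.* D)) * (D⁻¹ * D⁻¹)          ≈⟨ D²D⁻²≈1 ⟩
    1#                                         ∎
    where
    5M≡D² : 5 ℕ.* M ≡ D ℕ.* D
    5M≡D² = ≡.refl

  unit-vectors : ∀ i → inner R (vectors i) (vectors i) ≈ 1#
  unit-vectors i = begin
    inner R (vectors i) (vectors i)        ≈⟨ inner-vectors i i ⟩
    ⟦ gram i i ⟧ * (D⁻¹ * D⁻¹)             ≡⟨ ≡.cong (λ x → ⟦ x ⟧ * (D⁻¹ * D⁻¹)) (gram-diagonal i) ⟩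
    ⟦ ⟨ + (D ℕ.* D) , + 0 ⟩ ⟧ * (D⁻¹ * D⁻¹) ≈⟨ *-congʳ ⟦⟨ + (D ℕ.* D) ,0⟩⟧ ⟩
    fromℤ (+ (D ℕ.* D)) * (D⁻¹ * D⁻¹)      ≈⟨ D²D⁻²≈1 ⟩
    1#                                     ∎

  5⟨vᵢ,vⱼ⟩≈1 : ∀ i j → gram i j ≡ ⟨ + M , + 0 ⟩ → fromℕ R 5 * inner R (vectors i) (vectors j) ≈ 1#
  5⟨vᵢ,vⱼ⟩≈1 i j gram≡M = begin
    fromℕ R 5 * inner R (vectors i) (vectors j)       ≈⟨ *-congˡ (inner-vectors i j) ⟩
    fromℕ R 5 * (⟦ gram i j ⟧ * (D⁻¹ * D⁻¹))           ≡⟨ ≡.cong (λ x → fromℕ R 5 * (⟦ x ⟧ * (D⁻¹ * D⁻¹))) {gram i j} gram≡M ⟩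
    fromℕ R 5 * (⟦ ⟨ + M , + 0 ⟩ ⟧ * (D⁻¹ * D⁻¹))      ≈⟨ *-congˡ (*-congʳ ⟦⟨ + M ,0⟩⟧) ⟩
    fromℕ R 5 * (fromℤ (+ M) * (D⁻¹ * D⁻¹))           ≈⟨ 5MD⁻²≈1 ⟩
    1#                                                ∎

  5⟨vᵢ,vⱼ⟩≈-1 : ∀ i j → gram i j ≡ ⟨ ℤ.- + M , + 0 ⟩ → fromℕ R 5 * inner R (vectors i) (vectors j) ≈ - 1#
  5⟨vᵢ,vⱼ⟩≈-1 i j gram≡-M = begin
    fromℕ R 5 * inner R (vectors i) (vectors j)       ≈⟨ *-congˡ (inner-vectors i j) ⟩
    fromℕ R 5 * (⟦ gram i j ⟧ * (D⁻¹ * D⁻¹))           ≡⟨ ≡.cong (λ x → fromℕ R 5 * (⟦ x ⟧ * (D⁻¹ * D⁻¹))) {gram i j} gram≡-M ⟩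
    fromℕ R 5 * (⟦ ⟨ ℤ.- + M , + 0 ⟩ ⟧ * (D⁻¹ * D⁻¹))  ≈⟨ *-congˡ (*-congʳ (trans ⟦⟨ ℤ.- + M ,0⟩⟧ (fromℤ-homo-neg (+ M)))) ⟩
    fromℕ R 5 * (- fromℤ (+ M) * (D⁻¹ * D⁻¹))         ≈⟨ *-congˡ (-‿distribˡ-* (fromℤ (+ M)) (D⁻¹ * D⁻¹)) ⟨
    fromℕ R 5 * - (fromℤ (+ M) * (D⁻¹ * D⁻¹))         ≈⟨ -‿distribʳ-* (fromℕ R 5) (fromℤ (+ M) * (D⁻¹ * D⁻¹)) ⟨
    - (fromℕ R 5 * (fromℤ (+ M) * (D⁻¹ * D⁻¹)))       ≈⟨ -‿cong 5MD⁻²≈1 ⟩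
    - 1#                                              ∎

  equiangular : ∀ i j → i ≢ j →
    (fromℕ R 5 * inner R (vectors i) (vectors j) ≈ 1#) ⊎ (fromℕ R 5 * inner R (vectors i) (vectors j) ≈ - 1#)
  equiangular i j i≢j = Sum.map (5⟨vᵢ,vⱼ⟩≈1 i j) (5⟨vᵢ,vⱼ⟩≈-1 i j) (gram-off-diagonal i j i≢j)

mainTheorem2 : ∀ {c ℓ ℓ'} (R : CompleteOrderedField c ℓ ℓ') →
    let open CompleteOrderedField R in
    ∃ λ (v : Fin 56 → Fin 18 → Carrier) →
      (∀ i → inner R (v i) (v i) ≈ 1#) ×
      (∀ i j → i ≢ j →
        (fromℕ R 5 * inner R (v i) (v j) ≈ 1#) ⊎ (fromℕ R 5 * inner R (v i) (v j) ≈ - 1#))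
mainTheorem2 R = vectors , unit-vectors , equiangular
  where open Construction R
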